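{- For every $n\in\mathbb N$, the map $$\varphi:SC_{9,n}\to SC_{9,4n+10},\qquad (x,y,z,w)\mapsto(-2w-1,\,2x,\,-2z-1,\,2y)$$ is well defined and injective.
   Context: $\mathbb N=\{0,1,2,\ldots\}$. A partition $\lambda$ is determined by its arm set $A^+(\lambda)=\{\lambda_i-i:1\le i\le s\}$ and leg set $L^+(\lambda)=\{\lambda^*_i-i:1\le i\le s\}$ ($s=\#\{i:\lambda_i\ge i\}$, $\lambda^*$ the conjugate); any two finite subsets of $\mathbb N$ of equal size are the leg and arm sets of a unique partition. For $c=(c_0,\ldots,c_{t-1})\in\mathbb Z^t$ with coordinate sum $0$, $\lambda_c$ is the partition with arm set $\{qt+j:0\le q<c_j\}$ and leg set $\{qt+t-j-1:0\le q<-c_j\}$. $SC_{t,n}$ is the set of such $c$ with $|\lambda_c|=n$ and $\lambda_c^*=\lambda_c$. For $t=9$, a tuple $(x,y,z,w)\in\mathbb Z^4$ is identified with $(-w,-z,-y,-x,0,x,y,z,w)\in\mathbb Z^9$, and $SC_{9,n}$ is regarded as a set of such tuples. -}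

module Defs where

open import Data.Nat as ℕ using (ℕ; zero; suc; _≤?_; _⊔_)
open import Data.Integer as ℤ using (ℤ; +_; -_)
open import Data.Fin as Fin using (Fin; toℕ)
open import Data.List using (List; []; _∷_; map; length; filter; applyUpTo; foldr; allFin)
open import Data.Nat.ListAction using (sum)
open import Data.List.Relation.Unary.All using (All)
open import Data.List.Relation.Unary.Linked using (Linked)
open import Data.List.Membership.Propositional using (_∈_)
open import Data.Product using (Σ; ∃; _×_; _,_)
open import Data.Bool using (if_then_else_)
open import Relation.Nullary.Decidable using (⌊_⌋)
open import Relation.Binary.PropositionalEquality using (_≡_)
open import Function.Bundles using (_⇔_)

IsPartition : List ℕ → Set
IsPartition λs = All (0 ℕ.<_) λs × Linked ℕ._≥_ λs

size : List ℕ → ℕ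
size = sum

conj : List ℕ → List ℕ
conj λs = applyUpTo (λ k → length (filter (λ x → suc k ≤? x) λs)) (foldr _⊔_ 0 λs)

-- arm set A⁺(λ) = { λ_i - i : 1 ≤ i ≤ s },  s = #{ i : λ_i ≥ i }
-- (for a partition, λ_i ≥ i holds exactly for an initial segment of indices)
armsFrom : ℕ → List ℕ → List ℕ
armsFrom i [] = []
armsFrom i (x ∷ xs) = if ⌊ i ≤? x ⌋ then (x ℕ.∸ i) ∷ armsFrom (suc i) xs else []

armList : List ℕ → List ℕ
armList = armsFrom 1

legList : List ℕ → List ℕ
legList λs = armList (conj λs)

sumℤ : (t : ℕ) → (Fin t → ℤ) → ℤ
sumℤ t c = foldr ℤ._+_ (+ 0) (map c (allFin t))

InArmSet : (t : ℕ) → (Fin t → ℤ) → ℕ → Set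
InArmSet t c m = Σ (Fin t) λ j → Σ ℕ λ q → (+ q ℤ.< c j) × (m ≡ q ℕ.* t ℕ.+ toℕ j)

InLegSet : (t : ℕ) → (Fin t → ℤ) → ℕ → Set
InLegSet t c m = Σ (Fin t) λ j → Σ ℕ λ q → (+ q ℤ.< - c j) × (m ≡ q ℕ.* t ℕ.+ (t ℕ.∸ suc (toℕ j)))

IsLambdaC : (t : ℕ) → (Fin t → ℤ) → List ℕ → Set
IsLambdaC t c λs =
  IsPartition λs
  × (∀ m → (m ∈ armList λs) ⇔ InArmSet t c m)
  × (∀ m → (m ∈ legList λs) ⇔ InLegSet t c m)

SC : (t n : ℕ) → (Fin t → ℤ) → Set
SC t n c = (sumℤ t c ≡ + 0)
  × ∃ λ λs → IsLambdaC t c λs × (size λs ≡ n) × (conj λs ≡ λs)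

Tuple4 : Set
Tuple4 = ℤ × ℤ × ℤ × ℤ

embed9 : Tuple4 → Fin 9 → ℤ
embed9 (x , y , z , w) Fin.zero = - w
embed9 (x , y , z , w) (Fin.suc Fin.zero) = - z
embed9 (x , y , z , w) (Fin.suc (Fin.suc Fin.zero)) = - y
embed9 (x , y , z , w) (Fin.suc (Fin.suc (Fin.suc Fin.zero))) = - x
embed9 (x , y , z , w) (Fin.suc (Fin.suc (Fin.suc (Fin.suc Fin.zero)))) = + 0
embed9 (x , y , z , w) (Fin.suc (Fin.suc (Fin.suc (Fin.suc (Fin.suc Fin.zero))))) = x
embed9 (x , y , z , w) (Fin.suc (Fin.suc (Fin.suc (Fin.suc (Fin.suc (Fin.suc Fin.zero)))))) = y
embed9 (x , y , z , w) (Fin.suc (Fin.suc (Fin.suc (Fin.suc (Fin.suc (Fin.suc (Fin.suc Fin.zero))))))) = z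
embed9 (x , y , z , w) (Fin.suc (Fin.suc (Fin.suc (Fin.suc (Fin.suc (Fin.suc (Fin.suc (Fin.suc Fin.zero)))))))) = w

SC9 : ℕ → Tuple4 → Set
SC9 n v = SC 9 n (embed9 v)

φ : Tuple4 → Tuple4
φ (x , y , z , w) =
  ( ℤ.- (+ 2 ℤ.* w) ℤ.- + 1 , + 2 ℤ.* x , ℤ.- (+ 2 ℤ.* z) ℤ.- + 1 , + 2 ℤ.* y )

-- A self-conjugate partition is the union of its diagonal hooks, the i-th one having arm = leg = a_i
-- where a_1 > a_2 > ... is its arm set.  Removing the outermost hook leaves a self-conjugate partition,
-- so |λ| = Σ (2 a_i + 1); conversely every strictly decreasing list of arms is realised by nesting hooks.
-- The arm set of λ_c is the set of abacus positions q t + j with q < c_j, hence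
-- |λ_c| = Σ_j (t p_j² + (2j + 1 - t) p_j) with p_j = max (c_j, 0).  For t = 9 and c = (-w,-z,-y,-x,0,x,y,z,w)
-- the runners j and 8 - j pair up to |λ_c| = 9 (x² + y² + z² + w²) + 2x + 4y + 6z + 8w, which φ multiplies
-- by 4 and shifts by 10.  Such c are antisymmetric, so the leg set of λ_c equals its arm set, and nesting the
-- hooks whose arms form the arm set of λ_{φ v} yields λ_{φ v}, self-conjugate.  Each coordinate of φ is an
-- injective affine map.

module Submission where

open import Defs
open import Data.Nat as ℕ using (ℕ; zero; suc; _≤_; _<_; _≥_; _>_; _≤?_; _<?_; z≤n; s≤s; s≤s⁻¹)
open import Data.Nat.Induction using (<-wellFounded)
open import Data.Nat.ListAction using (sum)
open import Data.Nat.ListAction.Properties using (sum-++)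
open import Data.Integer as ℤ using (ℤ; -[1+_])
open import Data.Integer.Properties using (neg-involutive)
open import Data.Fin using (Fin; toℕ; fromℕ<; opposite)
open import Data.Fin.Properties using (toℕ<n; fromℕ<-toℕ; toℕ-fromℕ<; opposite-prop; opposite-involutive)
open import Data.List using (List; []; _∷_; map; length; filter; applyUpTo; foldr; replicate; _++_)
open import Data.List.Properties
  using ( length-++; length-applyUpTo; length-map; length-replicate; map-++
        ; filter-++; filter-all; filter-none; filter-accept; filter-reject)
open import Data.List.Relation.Unary.All as All using (All; []; _∷_)
import Data.List.Relation.Unary.All.Properties as All
open import Data.List.Relation.Unary.AllPairs as AllPairs using (AllPairs; []; _∷_)
import Data.List.Relation.Unary.AllPairs.Properties as AllPairs
open import Data.List.Relation.Unary.Linked using (Linked)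
open import Data.List.Relation.Unary.Linked.Properties using (Linked⇒AllPairs; AllPairs⇒Linked)
open import Data.List.Relation.Unary.Any using (here; there)
open import Data.List.Membership.Propositional using (_∈_)
open import Data.List.Membership.Propositional.Properties using (∈-++⁺ˡ; ∈-++⁺ʳ; ∈-++⁻)
open import Data.Product using (∃-syntax; _×_; _,_; proj₁)
open import Data.Sum using (inj₁; inj₂)
open import Data.Empty using (⊥-elim)
open import Function using (_∘_)
open import Function.Bundles using (_⇔_; mk⇔; Equivalence)
import Function.Properties.Equivalence as ⇔
open import Induction.WellFounded using (Acc; acc)
open import Relation.Nullary using (yes; no)
open import Relation.Binary.PropositionalEquality

module Partitions where

  open import Data.Nat using (_+_; _*_; _∸_; _⊔_; _⊓_)
  open import Data.Nat.Properties
  open import Data.Nat.Tactic.RingSolver using (solve-∀)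

  -- Self-conjugate partitions and their diagonal hooks

  Positive Decreasing StrictlyDecreasing : List ℕ → Set
  Positive = All (0 <_)
  Decreasing = AllPairs _≥_
  StrictlyDecreasing = AllPairs _>_

  linked⇒decreasing : ∀ {xs} → Linked _≥_ xs → Decreasing xs
  linked⇒decreasing = Linked⇒AllPairs (λ y≤x z≤y → ≤-trans z≤y y≤x)

  maximum : List ℕ → ℕ
  maximum = foldr _⊔_ 0

  -- conj l ≡ applyUpTo (λ k → countAbove k l) (maximum l) holds by definition.
  countAbove : ℕ → List ℕ → ℕ
  countAbove k l = length (filter (λ x → suc k ≤? x) l)

  entry : ℕ → List ℕ → ℕ
  entry k [] = 0
  entry zero (x ∷ _) = x
  entry (suc k) (_ ∷ xs) = entry k xs

  SelfConjugate : List ℕ → Set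
  SelfConjugate l = ∀ k → countAbove k l ≡ entry k l

  countAbove-∷-> : ∀ {k x} xs → k < x → countAbove k (x ∷ xs) ≡ suc (countAbove k xs)
  countAbove-∷-> xs k<x = cong length (filter-accept (λ x → _ ≤? x) k<x)

  countAbove-∷-≤ : ∀ {k x} xs → x ≤ k → countAbove k (x ∷ xs) ≡ countAbove k xs
  countAbove-∷-≤ xs x≤k = cong length (filter-reject (λ x → _ ≤? x) (≤⇒≯ x≤k))

  countAbove-++ : ∀ k xs ys → countAbove k (xs ++ ys) ≡ countAbove k xs + countAbove k ys
  countAbove-++ k xs ys = trans (cong length (filter-++ (λ x → suc k ≤? x) xs ys)) (length-++ (filter _ xs))

  countAbove-all : ∀ {k} xs → All (k <_) xs → countAbove k xs ≡ length xs
  countAbove-all xs k<xs = cong length (filter-all (λ x → _ ≤? x) k<xs)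

  countAbove-none : ∀ {k} xs → All (_≤ k) xs → countAbove k xs ≡ 0
  countAbove-none xs xs≤k = cong length (filter-none (λ x → _ ≤? x) (All.map ≤⇒≯ xs≤k))

  countAbove-map-suc : ∀ k xs → countAbove (suc k) (map suc xs) ≡ countAbove k xs
  countAbove-map-suc k [] = refl
  countAbove-map-suc k (x ∷ xs) with k <? x
  ... | yes k<x = trans (countAbove-∷-> (map suc xs) (s≤s k<x))
                    (trans (cong suc (countAbove-map-suc k xs)) (sym (countAbove-∷-> xs k<x)))
  ... | no k≮x = trans (countAbove-∷-≤ (map suc xs) (s≤s (≮⇒≥ k≮x)))
                   (trans (countAbove-map-suc k xs) (sym (countAbove-∷-≤ xs (≮⇒≥ k≮x))))

  entry-beyond : ∀ {k} xs → length xs ≤ k → entry k xs ≡ 0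
  entry-beyond [] _ = refl
  entry-beyond {suc k} (x ∷ xs) (s≤s |xs|≤k) = entry-beyond xs |xs|≤k

  entry-applyUpTo : ∀ f {n k} → k < n → entry k (applyUpTo f n) ≡ f k
  entry-applyUpTo f {suc n} {zero} _ = refl
  entry-applyUpTo f {suc n} {suc k} (s≤s k<n) = entry-applyUpTo (λ i → f (suc i)) k<n

  applyUpTo-entry : ∀ f xs → (∀ k → f k ≡ entry k xs) → applyUpTo f (length xs) ≡ xs
  applyUpTo-entry f [] _ = refl
  applyUpTo-entry f (x ∷ xs) f≡ = cong₂ _∷_ (f≡ 0) (applyUpTo-entry (λ i → f (suc i)) xs (λ k → f≡ (suc k)))

  maximum-bounded : ∀ {h} xs → All (_≤ h) xs → maximum xs ≤ h
  maximum-bounded [] _ = z≤n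
  maximum-bounded (x ∷ xs) (x≤h ∷ xs≤h) = ⊔-lub x≤h (maximum-bounded xs xs≤h)

  ≤-maximum : ∀ xs → All (_≤ maximum xs) xs
  ≤-maximum [] = []
  ≤-maximum (x ∷ xs) =
    m≤m⊔n x (maximum xs) ∷ All.map (λ y≤ → ≤-trans y≤ (m≤n⊔m x (maximum xs))) (≤-maximum xs)

  conj≡⇒selfConjugate : ∀ l → conj l ≡ l → SelfConjugate l
  conj≡⇒selfConjugate l conj≡ k with k <? maximum l
  ... | yes k<max = begin
    countAbove k l ≡⟨ entry-applyUpTo (λ i → countAbove i l) k<max ⟨
    entry k (conj l) ≡⟨ cong (entry k) conj≡ ⟩
    entry k l ∎
    where open ≡-Reasoning
  ... | no k≮max = begin
    countAbove k l ≡⟨ countAbove-none l (All.map (λ x≤ → ≤-trans x≤ (≮⇒≥ k≮max)) (≤-maximum l)) ⟩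
    0 ≡⟨ entry-beyond (conj l) (≤-trans (≤-reflexive (length-applyUpTo _ (maximum l))) (≮⇒≥ k≮max)) ⟨
    entry k (conj l) ≡⟨ cong (entry k) conj≡ ⟩
    entry k l ∎
    where open ≡-Reasoning

  selfConjugate⇒conj≡ : ∀ l → Positive l → Decreasing l → SelfConjugate l → conj l ≡ l
  selfConjugate⇒conj≡ [] _ _ _ = refl
  selfConjugate⇒conj≡ l@(h ∷ t) l>0 (t≤h ∷ _) sc =
    trans (cong (applyUpTo (λ k → countAbove k l)) maximum≡length) (applyUpTo-entry _ l sc)
    where
    open ≡-Reasoning
    maximum≡length : maximum l ≡ length l
    maximum≡length = begin
      maximum l ≡⟨ ≤-antisym (maximum-bounded l (≤-refl ∷ t≤h)) (m≤m⊔n h (maximum t)) ⟩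
      h ≡⟨ sc 0 ⟨
      countAbove 0 l ≡⟨ countAbove-all l l>0 ⟩
      length l ∎

  -- Q bordered on the left by a column of height length Q + m.
  addColumn : ℕ → List ℕ → List ℕ
  addColumn m Q = map suc Q ++ replicate m 1

  -- Q surrounded by a diagonal hook with arm and leg of length h (meaningful when length Q ≤ h).
  hookCons : ℕ → List ℕ → List ℕ
  hookCons h Q = suc h ∷ addColumn (h ∸ length Q) Q

  hookLength : ℕ → ℕ
  hookLength a = suc (a + a)

  hookSum : List ℕ → ℕ
  hookSum as = sum (map hookLength as)

  length-addColumn : ∀ m Q → length (addColumn m Q) ≡ length Q + m
  length-addColumn m Q = trans (length-++ (map suc Q)) (cong₂ _+_ (length-map suc Q) (length-replicate m))

  length-hookCons : ∀ {h} Q → length Q ≤ h → length (hookCons h Q) ≡ suc h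
  length-hookCons {h} Q |Q|≤h = cong suc (trans (length-addColumn (h ∸ length Q) Q) (m+[n∸m]≡n |Q|≤h))

  sum-replicate-1 : ∀ m → sum (replicate m 1) ≡ m
  sum-replicate-1 zero = refl
  sum-replicate-1 (suc m) = cong suc (sum-replicate-1 m)

  sum-addColumn : ∀ m Q → sum (addColumn m Q) ≡ sum Q + (length Q + m)
  sum-addColumn m [] = sum-replicate-1 m
  sum-addColumn m (q ∷ Q) = trans (cong (suc q +_) (sum-addColumn m Q)) (rearrange q (sum Q) (length Q) m)
    where
    rearrange : ∀ a b c d → suc a + (b + (c + d)) ≡ a + b + (suc c + d)
    rearrange = solve-∀

  size-hookCons : ∀ {h} Q → length Q ≤ h → size (hookCons h Q) ≡ hookLength h + size Q
  size-hookCons {h} Q |Q|≤h = begin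
    suc h + sum (addColumn (h ∸ length Q) Q) ≡⟨ cong (suc h +_) (sum-addColumn (h ∸ length Q) Q) ⟩
    suc h + (sum Q + (length Q + (h ∸ length Q))) ≡⟨ cong (λ n → suc h + (sum Q + n)) (m+[n∸m]≡n |Q|≤h) ⟩
    suc h + (sum Q + h) ≡⟨ rearrange h (sum Q) ⟩
    hookLength h + sum Q ∎
    where
    open ≡-Reasoning
    rearrange : ∀ a b → suc a + (b + a) ≡ suc (a + a) + b
    rearrange = solve-∀

  countAbove-addColumn : ∀ k m Q → countAbove (suc k) (addColumn m Q) ≡ countAbove k Q
  countAbove-addColumn k m Q = begin
    countAbove (suc k) (map suc Q ++ replicate m 1) ≡⟨ countAbove-++ (suc k) (map suc Q) (replicate m 1) ⟩
    countAbove (suc k) (map suc Q) + countAbove (suc k) (replicate m 1)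
      ≡⟨ cong₂ _+_ (countAbove-map-suc k Q) (countAbove-none (replicate m 1) (All.replicate⁺ m (s≤s z≤n))) ⟩
    countAbove k Q + 0 ≡⟨ +-identityʳ _ ⟩
    countAbove k Q ∎
    where open ≡-Reasoning

  entry-addColumn : ∀ {k} m Q → k < length Q + m → entry k (addColumn m Q) ≡ suc (entry k Q)
  entry-addColumn {zero} (suc m) [] _ = refl
  entry-addColumn {suc k} (suc m) [] (s≤s k<m) = entry-addColumn m [] k<m
  entry-addColumn {zero} m (q ∷ Q) _ = refl
  entry-addColumn {suc k} m (q ∷ Q) (s≤s k<) = entry-addColumn m Q k<

  armsFrom-∷-≤ : ∀ {i x} xs → i ≤ x → armsFrom i (x ∷ xs) ≡ (x ∸ i) ∷ armsFrom (suc i) xs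
  armsFrom-∷-≤ {i} {x} xs i≤x with i ≤? x
  ... | yes _ = refl
  ... | no i≰x = ⊥-elim (i≰x i≤x)

  armsFrom-∷-> : ∀ {i x} xs → x < i → armsFrom i (x ∷ xs) ≡ []
  armsFrom-∷-> {i} {x} xs x<i with i ≤? x
  ... | yes i≤x = ⊥-elim (<⇒≱ x<i i≤x)
  ... | no _ = refl

  armsFrom-addColumn : ∀ i m Q → armsFrom (suc (suc i)) (addColumn m Q) ≡ armsFrom (suc i) Q
  armsFrom-addColumn i zero [] = refl
  armsFrom-addColumn i (suc m) [] = refl
  armsFrom-addColumn i m (x ∷ Q) with ≤-<-connex (suc i) x
  ... | inj₁ i<x = begin
    armsFrom (suc (suc i)) (suc x ∷ addColumn m Q) ≡⟨ armsFrom-∷-≤ (addColumn m Q) (s≤s i<x) ⟩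
    (x ∸ suc i) ∷ armsFrom (suc (suc (suc i))) (addColumn m Q)
      ≡⟨ cong ((x ∸ suc i) ∷_) (armsFrom-addColumn (suc i) m Q) ⟩
    (x ∸ suc i) ∷ armsFrom (suc (suc i)) Q ≡⟨ armsFrom-∷-≤ Q i<x ⟨
    armsFrom (suc i) (x ∷ Q) ∎
    where open ≡-Reasoning
  ... | inj₂ x<1+i = trans (armsFrom-∷-> (addColumn m Q) (s≤s x<1+i)) (sym (armsFrom-∷-> Q x<1+i))

  armList-hookCons : ∀ h Q → armList (hookCons h Q) ≡ h ∷ armList Q
  armList-hookCons h Q = cong (h ∷_) (armsFrom-addColumn 0 (h ∸ length Q) Q)

  hookCons-positive : ∀ h Q → Positive (hookCons h Q)
  hookCons-positive h Q =
    s≤s z≤n ∷ All.++⁺ (All.map⁺ (All.universal (λ _ → s≤s z≤n) Q))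
                      (All.replicate⁺ (h ∸ length Q) (s≤s z≤n))

  replicate-decreasing : ∀ m x → Decreasing (replicate m x)
  replicate-decreasing zero x = []
  replicate-decreasing (suc m) x = All.replicate⁺ m ≤-refl ∷ replicate-decreasing m x

  addColumn-decreasing : ∀ m {Q} → Decreasing Q → Decreasing (addColumn m Q)
  addColumn-decreasing m {Q} dQ =
    AllPairs.++⁺ (AllPairs.map⁺ (AllPairs.map s≤s dQ)) (replicate-decreasing m 1)
      (All.map⁺ (All.universal (λ _ → All.replicate⁺ m (s≤s z≤n)) Q))

  addColumn-≤ : ∀ {h} m {Q} → All (_≤ h) Q → All (_≤ suc h) (addColumn m Q)
  addColumn-≤ m Q≤h = All.++⁺ (All.map⁺ (All.map s≤s Q≤h)) (All.replicate⁺ m (s≤s z≤n))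

  hookCons-decreasing : ∀ {h Q} → All (_≤ h) Q → Decreasing Q → Decreasing (hookCons h Q)
  hookCons-decreasing {h} {Q} Q≤h dQ = addColumn-≤ (h ∸ length Q) Q≤h ∷ addColumn-decreasing (h ∸ length Q) dQ

  countAbove-hookCons-< : ∀ {h k} Q → k < h → countAbove (suc k) (hookCons h Q) ≡ suc (countAbove k Q)
  countAbove-hookCons-< Q k<h =
    trans (countAbove-∷-> (addColumn _ Q) (s≤s k<h)) (cong suc (countAbove-addColumn _ _ Q))

  countAbove-hookCons-≥ : ∀ {h k} Q → h ≤ k → countAbove (suc k) (hookCons h Q) ≡ countAbove k Q
  countAbove-hookCons-≥ Q h≤k =
    trans (countAbove-∷-≤ (addColumn _ Q) (s≤s h≤k)) (countAbove-addColumn _ _ Q)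

  module _ {h : ℕ} (Q : List ℕ) (|Q|≤h : length Q ≤ h) where

    private
      |column|≡h : length (addColumn (h ∸ length Q) Q) ≡ h
      |column|≡h = trans (length-addColumn (h ∸ length Q) Q) (m+[n∸m]≡n |Q|≤h)

    entry-hookCons-< : ∀ {k} → k < h → entry (suc k) (hookCons h Q) ≡ suc (entry k Q)
    entry-hookCons-< k<h = entry-addColumn _ Q (≤-trans k<h (≤-reflexive (sym (m+[n∸m]≡n |Q|≤h))))

    entry-hookCons-≥ : ∀ {k} → h ≤ k → entry (suc k) (hookCons h Q) ≡ entry k Q
    entry-hookCons-≥ h≤k = trans (entry-beyond (addColumn _ Q) (≤-trans (≤-reflexive |column|≡h) h≤k))
                                  (sym (entry-beyond Q (≤-trans |Q|≤h h≤k)))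

    selfConjugate-hookCons : SelfConjugate (hookCons h Q) ⇔ SelfConjugate Q
    selfConjugate-hookCons = mk⇔ inner outer
      where
      inner : SelfConjugate (hookCons h Q) → SelfConjugate Q
      inner sc k with <-≤-connex k h
      ... | inj₁ k<h = suc-injective (trans (sym (countAbove-hookCons-< Q k<h)) (trans (sc (suc k)) (entry-hookCons-< k<h)))
      ... | inj₂ h≤k = trans (sym (countAbove-hookCons-≥ Q h≤k)) (trans (sc (suc k)) (entry-hookCons-≥ h≤k))
      outer : SelfConjugate Q → SelfConjugate (hookCons h Q)
      outer sc zero = trans (countAbove-all (hookCons h Q) (hookCons-positive h Q)) (cong suc |column|≡h)
      outer sc (suc k) with <-≤-connex k h
      ... | inj₁ k<h = trans (countAbove-hookCons-< Q k<h) (trans (cong suc (sc k)) (sym (entry-hookCons-< k<h)))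
      ... | inj₂ h≤k = trans (countAbove-hookCons-≥ Q h≤k) (trans (sc k) (sym (entry-hookCons-≥ h≤k)))

  decreasing⇒addColumn : ∀ t → Positive t → Decreasing t →
    ∃[ Q ] ∃[ m ] t ≡ addColumn m Q × Positive Q × Decreasing Q
  decreasing⇒addColumn [] _ _ = [] , 0 , refl , [] , []
  decreasing⇒addColumn (x ∷ t) (x>0 ∷ t>0) (t≤x ∷ dt) with decreasing⇒addColumn t t>0 dt
  decreasing⇒addColumn (suc zero ∷ _) _ _ | [] , m , refl , _ , _ = [] , suc m , refl , [] , []
  decreasing⇒addColumn (suc zero ∷ _) _ (t≤1 ∷ _) | q ∷ _ , m , refl , q>0 ∷ _ , _ =
    ⊥-elim (<⇒≱ q>0 (s≤s⁻¹ (All.head t≤1)))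
  decreasing⇒addColumn (suc (suc y) ∷ _) _ (t≤x ∷ _) | Q , m , refl , Q>0 , dQ =
    suc y ∷ Q , m , refl , s≤s z≤n ∷ Q>0 , All.map s≤s⁻¹ (All.map⁻ (All.++⁻ˡ (map suc Q) t≤x)) ∷ dQ

  selfConjugate⇒hookCons : ∀ x t → Positive (x ∷ t) → Decreasing (x ∷ t) → SelfConjugate (x ∷ t) →
    ∃[ h ] ∃[ Q ] x ∷ t ≡ hookCons h Q × length Q ≤ h × Positive Q × Decreasing Q
  selfConjugate⇒hookCons zero t (() ∷ _) _ _
  selfConjugate⇒hookCons (suc h) t l>0 (_ ∷ dt) sc with decreasing⇒addColumn t (All.tail l>0) dt
  ... | Q , m , refl , Q>0 , dQ =
    h , Q , cong (λ m → suc h ∷ addColumn m Q) m≡ , ≤-trans (m≤m+n (length Q) m) (≤-reflexive (sym h≡)) , Q>0 , dQ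
    where
    h≡ : h ≡ length Q + m
    h≡ = suc-injective (begin
      suc h ≡⟨ sc 0 ⟨
      countAbove 0 (suc h ∷ addColumn m Q) ≡⟨ countAbove-all (suc h ∷ addColumn m Q) l>0 ⟩
      suc (length (addColumn m Q)) ≡⟨ cong suc (length-addColumn m Q) ⟩
      suc (length Q + m) ∎)
      where open ≡-Reasoning
    m≡ : m ≡ h ∸ length Q
    m≡ = trans (sym (m+n∸m≡n (length Q) m)) (cong (_∸ length Q) (sym h≡))

  size≡hookSum-armList : ∀ l → Positive l → Decreasing l → SelfConjugate l → size l ≡ hookSum (armList l)
  size≡hookSum-armList l = go l (<-wellFounded (length l))
    where
    go : ∀ l → Acc _<_ (length l) → Positive l → Decreasing l → SelfConjugate l → size l ≡ hookSum (armList l)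
    go [] _ _ _ _ = refl
    go (x ∷ t) (acc rec) l>0 dl sc with selfConjugate⇒hookCons x t l>0 dl sc
    ... | h , Q , l≡ , |Q|≤h , Q>0 , dQ = begin
      size (x ∷ t) ≡⟨ cong size l≡ ⟩
      size (hookCons h Q) ≡⟨ size-hookCons Q |Q|≤h ⟩
      hookLength h + size Q ≡⟨ cong (hookLength h +_) (go Q (rec |Q|<|l|) Q>0 dQ scQ) ⟩
      hookSum (h ∷ armList Q) ≡⟨ cong hookSum (armList-hookCons h Q) ⟨
      hookSum (armList (hookCons h Q)) ≡⟨ cong (hookSum ∘ armList) l≡ ⟨
      hookSum (armList (x ∷ t)) ∎
      where
      open ≡-Reasoning
      scQ : SelfConjugate Q
      scQ = Equivalence.to (selfConjugate-hookCons Q |Q|≤h) (subst SelfConjugate l≡ sc)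
      |Q|<|l| : length Q < length (x ∷ t)
      |Q|<|l| = ≤-trans (s≤s |Q|≤h) (≤-reflexive (sym (trans (cong length l≡) (length-hookCons Q |Q|≤h))))

  -- For strictly decreasing as, the self-conjugate partition with arm set as.
  hookPartition : List ℕ → List ℕ
  hookPartition [] = []
  hookPartition (a ∷ as) = hookCons a (hookPartition as)

  hookPartition-length≤ : ∀ {a} as → StrictlyDecreasing (a ∷ as) → length (hookPartition as) ≤ a
  hookPartition-length≤ [] _ = z≤n
  hookPartition-length≤ (b ∷ bs) ((b<a ∷ _) ∷ sd) =
    ≤-trans (≤-reflexive (length-hookCons (hookPartition bs) (hookPartition-length≤ bs sd))) b<a

  hookPartition-≤ : ∀ {a} as → StrictlyDecreasing (a ∷ as) → All (_≤ a) (hookPartition as)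
  hookPartition-≤ [] _ = []
  hookPartition-≤ (b ∷ bs) ((b<a ∷ _) ∷ sd) =
    All.map (λ x≤1+b → ≤-trans x≤1+b b<a) (≤-refl ∷ addColumn-≤ _ (hookPartition-≤ bs sd))

  hookPartition-positive : ∀ as → Positive (hookPartition as)
  hookPartition-positive [] = []
  hookPartition-positive (a ∷ as) = hookCons-positive a (hookPartition as)

  hookPartition-decreasing : ∀ as → StrictlyDecreasing as → Decreasing (hookPartition as)
  hookPartition-decreasing [] _ = []
  hookPartition-decreasing (a ∷ as) sd@(_ ∷ sd′) =
    hookCons-decreasing (hookPartition-≤ as sd) (hookPartition-decreasing as sd′)

  hookPartition-selfConjugate : ∀ as → StrictlyDecreasing as → SelfConjugate (hookPartition as)
  hookPartition-selfConjugate [] _ k = refl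
  hookPartition-selfConjugate (a ∷ as) sd@(_ ∷ sd′) =
    Equivalence.from (selfConjugate-hookCons (hookPartition as) (hookPartition-length≤ as sd))
      (hookPartition-selfConjugate as sd′)

  armList-hookPartition : ∀ as → armList (hookPartition as) ≡ as
  armList-hookPartition [] = refl
  armList-hookPartition (a ∷ as) = trans (armList-hookCons a (hookPartition as)) (cong (a ∷_) (armList-hookPartition as))

  armsFrom-bounded : ∀ {x} i xs → All (_≤ x) xs → All (λ a → a + i ≤ x) (armsFrom i xs)
  armsFrom-bounded i [] _ = []
  armsFrom-bounded i (y ∷ ys) (y≤x ∷ ys≤x) with ≤-<-connex i y
  ... | inj₁ i≤y rewrite armsFrom-∷-≤ ys i≤y =
    ≤-trans (≤-reflexive (m∸n+n≡m i≤y)) y≤x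
      ∷ All.map (λ {a} a+1+i≤x → ≤-trans (+-monoʳ-≤ a (n≤1+n i)) a+1+i≤x) (armsFrom-bounded (suc i) ys ys≤x)
  ... | inj₂ y<i rewrite armsFrom-∷-> ys y<i = []

  armsFrom-strictlyDecreasing : ∀ i xs → Decreasing xs → StrictlyDecreasing (armsFrom i xs)
  armsFrom-strictlyDecreasing i [] _ = []
  armsFrom-strictlyDecreasing i (y ∷ ys) (ys≤y ∷ dys) with ≤-<-connex i y
  ... | inj₁ i≤y rewrite armsFrom-∷-≤ ys i≤y =
    All.map (λ {a} a+1+i≤y → m+n≤o⇒m≤o∸n (suc a) (≤-trans (≤-reflexive (sym (+-suc a i))) a+1+i≤y))
            (armsFrom-bounded (suc i) ys ys≤y)
      ∷ armsFrom-strictlyDecreasing (suc i) ys dys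
  ... | inj₂ y<i rewrite armsFrom-∷-> ys y<i = []

  strictlyDecreasing-≡ : ∀ {xs ys} → StrictlyDecreasing xs → StrictlyDecreasing ys →
    (∀ m → m ∈ xs ⇔ m ∈ ys) → xs ≡ ys
  strictlyDecreasing-≡ [] [] _ = refl
  strictlyDecreasing-≡ [] (_ ∷ _) same with Equivalence.from (same _) (here refl)
  ... | ()
  strictlyDecreasing-≡ (_ ∷ _) [] same with Equivalence.to (same _) (here refl)
  ... | ()
  strictlyDecreasing-≡ {x ∷ xs} {y ∷ ys} (xs<x ∷ sdx) (ys<y ∷ sdy) same =
    cong₂ _∷_ x≡y (strictlyDecreasing-≡ sdx sdy same-tail)
    where
    open Equivalence
    x≡y : x ≡ y
    x≡y with to (same x) (here refl) | from (same y) (here refl)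
    ... | here x≡y | _ = x≡y
    ... | there _ | here y≡x = sym y≡x
    ... | there x∈ys | there y∈xs = ⊥-elim (<-asym (All.lookup ys<y x∈ys) (All.lookup xs<x y∈xs))
    below-head : ∀ {m z zs} → m < z → m ∈ z ∷ zs → m ∈ zs
    below-head m<z (here refl) = ⊥-elim (<-irrefl refl m<z)
    below-head _ (there m∈zs) = m∈zs
    same-tail : ∀ m → m ∈ xs ⇔ m ∈ ys
    same-tail m = mk⇔
      (λ m∈xs → below-head (subst (m <_) x≡y (All.lookup xs<x m∈xs)) (to (same m) (there m∈xs)))
      (λ m∈ys → below-head (subst (m <_) (sym x≡y) (All.lookup ys<y m∈ys)) (from (same m) (there m∈ys)))

  -- The abacus and the partitions λ_c

  sumBelow : ℕ → (ℕ → ℕ) → ℕ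
  sumBelow zero f = 0
  sumBelow (suc n) f = f n + sumBelow n f

  sumBelow-cong : ∀ n {f g} → (∀ {j} → j < n → f j ≡ g j) → sumBelow n f ≡ sumBelow n g
  sumBelow-cong zero _ = refl
  sumBelow-cong (suc n) f≡g = cong₂ _+_ (f≡g ≤-refl) (sumBelow-cong n (λ j<n → f≡g (m<n⇒m<1+n j<n)))

  sumBelow-+ : ∀ n f g → sumBelow n (λ j → f j + g j) ≡ sumBelow n f + sumBelow n g
  sumBelow-+ zero f g = refl
  sumBelow-+ (suc n) f g = trans (cong (f n + g n +_) (sumBelow-+ n f g)) (+-+-comm (f n) (g n) (sumBelow n f) (sumBelow n g))
    where
    +-+-comm : ∀ a b c d → a + b + (c + d) ≡ a + c + (b + d)
    +-+-comm = solve-∀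

  ≤-sumBelow : ∀ {n j} f → j < n → f j ≤ sumBelow n f
  ≤-sumBelow {suc n} f j<1+n with m≤n⇒m<n∨m≡n (s≤s⁻¹ j<1+n)
  ... | inj₁ j<n = ≤-trans (≤-sumBelow f j<n) (m≤n+m (sumBelow n f) (f n))
  ... | inj₂ refl = m≤m+n (f n) (sumBelow n f)

  hookSum-++ : ∀ xs ys → hookSum (xs ++ ys) ≡ hookSum xs + hookSum ys
  hookSum-++ xs ys = trans (cong sum (map-++ hookLength xs ys)) (sum-++ (map hookLength xs) (map hookLength ys))

  sumBelow-zero : ∀ n → sumBelow n (λ _ → 0) ≡ 0
  sumBelow-zero zero = refl
  sumBelow-zero (suc n) = sumBelow-zero n

  runnerSum : ℕ → ℕ → ℕ → ℕ
  runnerSum t j m = sumBelow m (λ q → hookLength (q * t + j))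

  -- Abacus with t runners, runner j carrying p j beads: bead q of runner j sits at position q * t + j.
  module Abacus (t : ℕ) (p : ℕ → ℕ) where

    bead : ℕ → ℕ → List ℕ
    bead q j with q <? p j
    ... | yes _ = q * t + j ∷ []
    ... | no _ = []

    level : ℕ → ℕ → List ℕ
    level q zero = []
    level q (suc j) = bead q j ++ level q j

    beads : ℕ → List ℕ
    beads zero = []
    beads (suc Q) = level Q t ++ beads Q

    IsBead : ℕ → ℕ → ℕ → Set
    IsBead q j m = q < p j × m ≡ q * t + j

    ∈-bead⇔ : ∀ {m q j} → m ∈ bead q j ⇔ IsBead q j m
    ∈-bead⇔ {m} {q} {j} with q <? p j
    ... | yes q<p = mk⇔ (λ { (here m≡) → q<p , m≡ }) (λ (_ , m≡) → here m≡)
    ... | no q≮p = mk⇔ (λ ()) (λ (q<p , _) → ⊥-elim (q≮p q<p))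

    ∈-level⇔ : ∀ {m q} J → m ∈ level q J ⇔ (∃[ j ] j < J × IsBead q j m)
    ∈-level⇔ zero = mk⇔ (λ ()) (λ { (_ , () , _) })
    ∈-level⇔ {m} {q} (suc J) = mk⇔ to from
      where
      to : m ∈ level q (suc J) → ∃[ j ] j < suc J × IsBead q j m
      to m∈ with ∈-++⁻ (bead q J) m∈
      ... | inj₁ m∈bead = J , ≤-refl , Equivalence.to ∈-bead⇔ m∈bead
      ... | inj₂ m∈level with Equivalence.to (∈-level⇔ J) m∈level
      ...   | j , j<J , isBead = j , m<n⇒m<1+n j<J , isBead
      from : ∃[ j ] j < suc J × IsBead q j m → m ∈ level q (suc J)
      from (j , j<1+J , isBead) with m≤n⇒m<n∨m≡n (s≤s⁻¹ j<1+J)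
      ... | inj₁ j<J = ∈-++⁺ʳ (bead q J) (Equivalence.from (∈-level⇔ J) (j , j<J , isBead))
      ... | inj₂ refl = ∈-++⁺ˡ (Equivalence.from ∈-bead⇔ isBead)

    ∈-beads⇔ : ∀ {m} Q → m ∈ beads Q ⇔ (∃[ q ] ∃[ j ] q < Q × j < t × IsBead q j m)
    ∈-beads⇔ zero = mk⇔ (λ ()) (λ { (_ , _ , () , _) })
    ∈-beads⇔ {m} (suc Q) = mk⇔ to from
      where
      to : m ∈ beads (suc Q) → ∃[ q ] ∃[ j ] q < suc Q × j < t × IsBead q j m
      to m∈ with ∈-++⁻ (level Q t) m∈
      ... | inj₁ m∈level with Equivalence.to (∈-level⇔ t) m∈level
      ...   | j , j<t , isBead = Q , j , ≤-refl , j<t , isBead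
      to m∈ | inj₂ m∈beads with Equivalence.to (∈-beads⇔ Q) m∈beads
      ...   | q , j , q<Q , j<t , isBead = q , j , m<n⇒m<1+n q<Q , j<t , isBead
      from : ∃[ q ] ∃[ j ] q < suc Q × j < t × IsBead q j m → m ∈ beads (suc Q)
      from (q , j , q<1+Q , j<t , isBead) with m≤n⇒m<n∨m≡n (s≤s⁻¹ q<1+Q)
      ... | inj₁ q<Q = ∈-++⁺ʳ (level Q t) (Equivalence.from (∈-beads⇔ Q) (q , j , q<Q , j<t , isBead))
      ... | inj₂ refl = ∈-++⁺ˡ (Equivalence.from (∈-level⇔ t) (j , j<t , isBead))

    position-< : ∀ {q Q j} → q < Q → j < t → q * t + j < Q * t
    position-< {q} {Q} {j} q<Q j<t = begin-strict
      q * t + j <⟨ +-monoʳ-< (q * t) j<t ⟩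
      q * t + t ≡⟨ +-comm (q * t) t ⟩
      suc q * t ≤⟨ *-monoˡ-≤ t q<Q ⟩
      Q * t ∎
      where open ≤-Reasoning

    bead-strictlyDecreasing : ∀ q j → StrictlyDecreasing (bead q j)
    bead-strictlyDecreasing q j with q <? p j
    ... | yes _ = [] ∷ []
    ... | no _ = []

    level-strictlyDecreasing : ∀ q J → StrictlyDecreasing (level q J)
    level-strictlyDecreasing q zero = []
    level-strictlyDecreasing q (suc J) =
      AllPairs.++⁺ (bead-strictlyDecreasing q J) (level-strictlyDecreasing q J)
        (All.tabulate λ m∈bead → All.tabulate λ m′∈level → below m∈bead m′∈level)
      where
      below : ∀ {m m′} → m ∈ bead q J → m′ ∈ level q J → m′ < m
      below m∈bead m′∈level with Equivalence.to ∈-bead⇔ m∈bead | Equivalence.to (∈-level⇔ J) m′∈level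
      ... | _ , refl | _ , j<J , _ , refl = +-monoʳ-< (q * t) j<J

    beads-strictlyDecreasing : ∀ Q → StrictlyDecreasing (beads Q)
    beads-strictlyDecreasing zero = []
    beads-strictlyDecreasing (suc Q) =
      AllPairs.++⁺ (level-strictlyDecreasing Q t) (beads-strictlyDecreasing Q)
        (All.tabulate λ m∈level → All.tabulate λ m′∈beads → below m∈level m′∈beads)
      where
      below : ∀ {m m′} → m ∈ level Q t → m′ ∈ beads Q → m′ < m
      below m∈level m′∈beads with Equivalence.to (∈-level⇔ t) m∈level | Equivalence.to (∈-beads⇔ Q) m′∈beads
      ... | j , _ , _ , refl | _ , _ , q<Q , j′<t , _ , refl = <-≤-trans (position-< q<Q j′<t) (m≤m+n (Q * t) j)

    hookSum-level : ∀ q J → hookSum (level q J) ≡ sumBelow J (λ j → hookSum (bead q j))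
    hookSum-level q zero = refl
    hookSum-level q (suc J) = trans (hookSum-++ (bead q J) (level q J)) (cong (hookSum (bead q J) +_) (hookSum-level q J))

    runnerSum-suc-⊓ : ∀ Q j → runnerSum t j (suc Q ⊓ p j) ≡ hookSum (bead Q j) + runnerSum t j (Q ⊓ p j)
    runnerSum-suc-⊓ Q j with Q <? p j
    ... | yes Q<p rewrite m≤n⇒m⊓n≡m Q<p | m≤n⇒m⊓n≡m (<⇒≤ Q<p) =
      cong (_+ runnerSum t j Q) (sym (+-identityʳ _))
    ... | no Q≮p rewrite m≥n⇒m⊓n≡n (≮⇒≥ Q≮p) | m≥n⇒m⊓n≡n (m≤n⇒m≤1+n (≮⇒≥ Q≮p)) = refl

    hookSum-beads : ∀ Q → hookSum (beads Q) ≡ sumBelow t (λ j → runnerSum t j (Q ⊓ p j))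
    hookSum-beads zero = sym (sumBelow-zero t)
    hookSum-beads (suc Q) = begin
      hookSum (level Q t ++ beads Q) ≡⟨ hookSum-++ (level Q t) (beads Q) ⟩
      hookSum (level Q t) + hookSum (beads Q) ≡⟨ cong₂ _+_ (hookSum-level Q t) (hookSum-beads Q) ⟩
      sumBelow t (λ j → hookSum (bead Q j)) + sumBelow t (λ j → runnerSum t j (Q ⊓ p j))
        ≡⟨ sumBelow-+ t (λ j → hookSum (bead Q j)) (λ j → runnerSum t j (Q ⊓ p j)) ⟨
      sumBelow t (λ j → hookSum (bead Q j) + runnerSum t j (Q ⊓ p j))
        ≡⟨ sumBelow-cong t (λ {j} _ → sym (runnerSum-suc-⊓ Q j)) ⟩
      sumBelow t (λ j → runnerSum t j (suc Q ⊓ p j)) ∎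
      where open ≡-Reasoning

  positivePart : ℤ → ℕ
  positivePart (ℤ.+ n) = n
  positivePart -[1+ n ] = 0

  <-positivePart⇔ : ∀ {q} c → q < positivePart c ⇔ ℤ.+ q ℤ.< c
  <-positivePart⇔ (ℤ.+ n) = mk⇔ ℤ.+<+ (λ { (ℤ.+<+ q<n) → q<n })
  <-positivePart⇔ -[1+ n ] = mk⇔ (λ ()) (λ ())

  -- The number of beads on runner j of the abacus of c; 0 for j ≥ t.
  beadCount : (t : ℕ) → (Fin t → ℤ) → ℕ → ℕ
  beadCount t c j with j <? t
  ... | yes j<t = positivePart (c (fromℕ< j<t))
  ... | no _ = 0

  beadCount-fromℕ< : ∀ {t} c {j} (j<t : j < t) → beadCount t c j ≡ positivePart (c (fromℕ< j<t))
  beadCount-fromℕ< {t} c {j} j<t with j <? t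
  ... | yes _ = refl
  ... | no j≮t = ⊥-elim (j≮t j<t)

  beadCount-toℕ : ∀ {t} c (j : Fin t) → beadCount t c (toℕ j) ≡ positivePart (c j)
  beadCount-toℕ c j = trans (beadCount-fromℕ< c (toℕ<n j)) (cong (positivePart ∘ c) (fromℕ<-toℕ j (toℕ<n j)))

  beadBound : (t : ℕ) → (Fin t → ℤ) → ℕ
  beadBound t c = sumBelow t (beadCount t c)

  beadCount≤beadBound : ∀ {t} c {j} → j < t → beadCount t c j ≤ beadBound t c
  beadCount≤beadBound c j<t = ≤-sumBelow (beadCount _ c) j<t

  armSet : (t : ℕ) → (Fin t → ℤ) → List ℕ
  armSet t c = Abacus.beads t (beadCount t c) (beadBound t c)

  sizeλ : (t : ℕ) → (Fin t → ℤ) → ℕ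
  sizeλ t c = sumBelow t (λ j → runnerSum t j (beadCount t c j))

  module _ {t : ℕ} (c : Fin t → ℤ) where

    open Abacus t (beadCount t c)

    ∈-armSet⇔ : ∀ m → m ∈ armSet t c ⇔ InArmSet t c m
    ∈-armSet⇔ m = ⇔.trans (∈-beads⇔ (beadBound t c)) (mk⇔ to from)
      where
      to : (∃[ q ] ∃[ j ] q < beadBound t c × j < t × IsBead q j m) → InArmSet t c m
      to (q , j , _ , j<t , q<p , m≡) =
        fromℕ< j<t , q , Equivalence.to (<-positivePart⇔ _) (subst (q <_) (beadCount-fromℕ< c j<t) q<p) ,
        trans m≡ (cong (q * t +_) (sym (toℕ-fromℕ< j<t)))
      from : InArmSet t c m → ∃[ q ] ∃[ j ] q < beadBound t c × j < t × IsBead q j m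
      from (j , q , q<c , m≡) =
        q , toℕ j , <-≤-trans q<p (beadCount≤beadBound c (toℕ<n j)) , toℕ<n j , q<p , m≡
        where
        q<p : q < beadCount t c (toℕ j)
        q<p = subst (q <_) (sym (beadCount-toℕ c j)) (Equivalence.from (<-positivePart⇔ (c j)) q<c)

    hookSum-armSet : hookSum (armSet t c) ≡ sizeλ t c
    hookSum-armSet = trans (hookSum-beads (beadBound t c))
      (sumBelow-cong t (λ j<t → cong (runnerSum t _) (m≥n⇒m⊓n≡n (beadCount≤beadBound c j<t))))

    armList≡armSet : ∀ {λs} → IsLambdaC t c λs → armList λs ≡ armSet t c
    armList≡armSet {λs} ((_ , linked) , arms , _) =
      strictlyDecreasing-≡ (armsFrom-strictlyDecreasing 1 λs (linked⇒decreasing linked))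
        (beads-strictlyDecreasing (beadBound t c)) (λ m → ⇔.trans (arms m) (⇔.sym (∈-armSet⇔ m)))

    size≡sizeλ : ∀ {λs} → IsLambdaC t c λs → conj λs ≡ λs → size λs ≡ sizeλ t c
    size≡sizeλ {λs} isλ@(((pos , linked) , _)) conj≡ = begin
      size λs ≡⟨ size≡hookSum-armList λs pos (linked⇒decreasing linked) (conj≡⇒selfConjugate λs conj≡) ⟩
      hookSum (armList λs) ≡⟨ cong hookSum (armList≡armSet isλ) ⟩
      hookSum (armSet t c) ≡⟨ hookSum-armSet ⟩
      sizeλ t c ∎
      where open ≡-Reasoning

    module _ (antisymmetric : ∀ j → c (opposite j) ≡ ℤ.- c j) where

      InLegSet⇔InArmSet : ∀ m → InLegSet t c m ⇔ InArmSet t c m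
      InLegSet⇔InArmSet m = mk⇔ to from
        where
        to : InLegSet t c m → InArmSet t c m
        to (j , q , q<-c , m≡) =
          opposite j , q , subst (ℤ.+ q ℤ.<_) (sym (antisymmetric j)) q<-c ,
          trans m≡ (cong (q * t +_) (sym (opposite-prop j)))
        from : InArmSet t c m → InLegSet t c m
        from (j , q , q<c , m≡) =
          opposite j , q ,
          subst (ℤ.+ q ℤ.<_) (trans (sym (neg-involutive (c j))) (cong ℤ.-_ (sym (antisymmetric j)))) q<c ,
          trans m≡ (cong (q * t +_) (trans (cong toℕ (sym (opposite-involutive j))) (opposite-prop (opposite j))))

      selfConjugate-λ : ∃[ μ ] IsLambdaC t c μ × size μ ≡ sizeλ t c × conj μ ≡ μ
      selfConjugate-λ = μ , (partition , arms , legs) , size≡ , conj≡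
        where
        sd = beads-strictlyDecreasing (beadBound t c)
        μ = hookPartition (armSet t c)
        partition : IsPartition μ
        partition = hookPartition-positive (armSet t c) , AllPairs⇒Linked (hookPartition-decreasing (armSet t c) sd)
        conj≡ : conj μ ≡ μ
        conj≡ = selfConjugate⇒conj≡ μ (proj₁ partition) (hookPartition-decreasing (armSet t c) sd)
                  (hookPartition-selfConjugate (armSet t c) sd)
        arms : ∀ m → m ∈ armList μ ⇔ InArmSet t c m
        arms m = subst (λ l → m ∈ l ⇔ InArmSet t c m) (sym (armList-hookPartition (armSet t c))) (∈-armSet⇔ m)
        legs : ∀ m → m ∈ legList μ ⇔ InLegSet t c m
        legs m = subst (λ l → m ∈ armList l ⇔ InLegSet t c m) (sym conj≡)
                   (⇔.trans (arms m) (⇔.sym (InLegSet⇔InArmSet m)))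
        size≡ : size μ ≡ sizeλ t c
        size≡ = size≡sizeλ (partition , arms , legs) conj≡

open Partitions

module NineRunners where

  open import Data.Integer using (+_; -_; _+_; _-_; _*_; +[1+_])
  open import Data.Integer.Properties using (+-injective; pos-+; pos-*; neg-injective; *-cancelˡ-≡; +-assoc)
  open import Data.Integer.Tactic.RingSolver using (solve-∀)
  import Data.Nat.Tactic.RingSolver as ℕ-Solver
  open import Data.Fin using (zero; suc)
  open import Data.Product.Properties using (,-injective)

  quadratic : ℕ → ℤ → ℤ → ℤ
  quadratic t d m = + t * (m * m) + d * m

  pos-hookLength : ∀ x → + hookLength x ≡ + 1 + + x + + x
  pos-hookLength x =
    trans (pos-+ 1 (x ℕ.+ x)) (trans (cong (λ X → + 1 + X) (pos-+ x x)) (sym (+-assoc (+ 1) (+ x) (+ x))))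

  runnerSum-quadratic : ∀ t j m → + runnerSum t j m ≡ quadratic t (+ 2 * + j + + 1 - + t) (+ m)
  runnerSum-quadratic t j zero = at-zero (+ t) (+ 2 * + j + + 1 - + t)
    where
    at-zero : ∀ T D → + 0 ≡ T * (+ 0 * + 0) + D * + 0
    at-zero = solve-∀
  runnerSum-quadratic t j (suc m) = begin
    + (hookLength (m ℕ.* t ℕ.+ j) ℕ.+ runnerSum t j m) ≡⟨ pos-+ (hookLength (m ℕ.* t ℕ.+ j)) (runnerSum t j m) ⟩
    + hookLength (m ℕ.* t ℕ.+ j) + + runnerSum t j m
      ≡⟨ cong₂ _+_ (pos-hookLength (m ℕ.* t ℕ.+ j)) (runnerSum-quadratic t j m) ⟩
    + 1 + + (m ℕ.* t ℕ.+ j) + + (m ℕ.* t ℕ.+ j) + quadratic t d (+ m)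
      ≡⟨ cong (λ X → + 1 + X + X + quadratic t d (+ m)) position ⟩
    + 1 + (+ m * + t + + j) + (+ m * + t + + j) + quadratic t d (+ m) ≡⟨ step (+ m) (+ t) (+ j) ⟩
    quadratic t d (+ 1 + + m) ≡⟨ cong (quadratic t d) (pos-+ 1 m) ⟨
    quadratic t d (+ suc m) ∎
    where
    open ≡-Reasoning
    d = + 2 * + j + + 1 - + t
    position : + (m ℕ.* t ℕ.+ j) ≡ + m * + t + + j
    position = trans (pos-+ (m ℕ.* t) j) (cong (λ X → X + + j) (pos-* m t))
    step : ∀ M T J → + 1 + (M * T + J) + (M * T + J) + (T * (M * M) + (+ 2 * J + + 1 - T) * M)
                     ≡ T * ((+ 1 + M) * (+ 1 + M)) + (+ 2 * J + + 1 - T) * (+ 1 + M)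
    step = solve-∀

  quadratic-positivePart : ∀ t d c →
    quadratic t d (+ positivePart c) + quadratic t (- d) (+ positivePart (- c)) ≡ quadratic t d c
  quadratic-positivePart t d (+ zero) = at-zero (+ t) d
    where
    at-zero : ∀ T D → T * (+ 0 * + 0) + D * + 0 + (T * (+ 0 * + 0) + (- D) * + 0) ≡ T * (+ 0 * + 0) + D * + 0
    at-zero = solve-∀
  quadratic-positivePart t d +[1+ n ] = positive (+ t) d +[1+ n ]
    where
    positive : ∀ T D N → T * (N * N) + D * N + (T * (+ 0 * + 0) + (- D) * + 0) ≡ T * (N * N) + D * N
    positive = solve-∀
  quadratic-positivePart t d -[1+ n ] = negative (+ t) d +[1+ n ]
    where
    negative : ∀ T D N → T * (+ 0 * + 0) + D * + 0 + (T * (N * N) + (- D) * N) ≡ T * ((- N) * (- N)) + D * (- N)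
    negative = solve-∀

  -- Runners j and k = t - 1 - j have opposite linear coefficients 2j + 1 - t and 2k + 1 - t.
  runnerSum-pair : ∀ {t} j k → t ≡ suc (j ℕ.+ k) → ∀ c →
    + (runnerSum t j (positivePart c) ℕ.+ runnerSum t k (positivePart (- c))) ≡ quadratic t (+ 2 * + j + + 1 - + t) c
  runnerSum-pair {t} j k refl c = begin
    + (runnerSum t j (positivePart c) ℕ.+ runnerSum t k (positivePart (- c)))
      ≡⟨ pos-+ (runnerSum t j (positivePart c)) (runnerSum t k (positivePart (- c))) ⟩
    + runnerSum t j (positivePart c) + + runnerSum t k (positivePart (- c))
      ≡⟨ cong₂ _+_ (runnerSum-quadratic t j (positivePart c)) (runnerSum-quadratic t k (positivePart (- c))) ⟩
    quadratic t dj (+ positivePart c) + quadratic t dk (+ positivePart (- c))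
      ≡⟨ cong (λ d → quadratic t dj (+ positivePart c) + quadratic t d (+ positivePart (- c))) dk≡-dj ⟩
    quadratic t dj (+ positivePart c) + quadratic t (- dj) (+ positivePart (- c)) ≡⟨ quadratic-positivePart t dj c ⟩
    quadratic t dj c ∎
    where
    open ≡-Reasoning
    dj = + 2 * + j + + 1 - + t
    dk = + 2 * + k + + 1 - + t
    opposite-coefficients : ∀ J K → + 2 * K + + 1 - (+ 1 + (J + K)) ≡ - (+ 2 * J + + 1 - (+ 1 + (J + K)))
    opposite-coefficients = solve-∀
    dk≡-dj : dk ≡ - dj
    dk≡-dj = begin
      + 2 * + k + + 1 - + t ≡⟨ cong (λ T → + 2 * + k + + 1 - T) pos-t ⟩
      + 2 * + k + + 1 - (+ 1 + (+ j + + k)) ≡⟨ opposite-coefficients (+ j) (+ k) ⟩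
      - (+ 2 * + j + + 1 - (+ 1 + (+ j + + k))) ≡⟨ cong (λ T → - (+ 2 * + j + + 1 - T)) pos-t ⟨
      - dj ∎
      where
      pos-t : + t ≡ + 1 + (+ j + + k)
      pos-t = trans (pos-+ 1 (j ℕ.+ k)) (cong (λ X → + 1 + X) (pos-+ j k))

  size9 : Tuple4 → ℤ
  size9 (x , y , z , w) = quadratic 9 (+ 2) x + quadratic 9 (+ 4) y + quadratic 9 (+ 6) z + quadratic 9 (+ 8) w

  sizeλ-embed9 : ∀ v → + sizeλ 9 (embed9 v) ≡ size9 v
  sizeλ-embed9 v@(x , y , z , w) = begin
    + sizeλ 9 (embed9 v) ≡⟨ cong +_ (pair-up (r 8) (r 7) (r 6) (r 5) (r 3) (r 2) (r 1) (r 0)) ⟩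
    + ((r 5 ℕ.+ r 3) ℕ.+ (r 6 ℕ.+ r 2) ℕ.+ (r 7 ℕ.+ r 1) ℕ.+ (r 8 ℕ.+ r 0))
      ≡⟨ pos-+₄ (r 5 ℕ.+ r 3) (r 6 ℕ.+ r 2) (r 7 ℕ.+ r 1) (r 8 ℕ.+ r 0) ⟩
    + (r 5 ℕ.+ r 3) + + (r 6 ℕ.+ r 2) + + (r 7 ℕ.+ r 1) + + (r 8 ℕ.+ r 0)
      ≡⟨ cong₂ _+_ (cong₂ _+_ (cong₂ _+_ (runnerSum-pair 5 3 refl x) (runnerSum-pair 6 2 refl y))
                              (runnerSum-pair 7 1 refl z))
                   (runnerSum-pair 8 0 refl w) ⟩
    size9 v ∎
    where
    open ≡-Reasoning
    r : ℕ → ℕ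
    r j = runnerSum 9 j (beadCount 9 (embed9 v) j)
    pair-up : ∀ a8 a7 a6 a5 a3 a2 a1 a0 →
      a8 ℕ.+ (a7 ℕ.+ (a6 ℕ.+ (a5 ℕ.+ (0 ℕ.+ (a3 ℕ.+ (a2 ℕ.+ (a1 ℕ.+ (a0 ℕ.+ 0))))))))
        ≡ (a5 ℕ.+ a3) ℕ.+ (a6 ℕ.+ a2) ℕ.+ (a7 ℕ.+ a1) ℕ.+ (a8 ℕ.+ a0)
    pair-up = ℕ-Solver.solve-∀
    pos-+₄ : ∀ a b c d → + (a ℕ.+ b ℕ.+ c ℕ.+ d) ≡ + a + + b + + c + + d
    pos-+₄ a b c d = trans (pos-+ (a ℕ.+ b ℕ.+ c) d)
      (cong (λ X → X + + d) (trans (pos-+ (a ℕ.+ b) c) (cong (λ X → X + + c) (pos-+ a b))))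

  size9-φ : ∀ v → size9 (φ v) ≡ + 4 * size9 v + + 10
  size9-φ (x , y , z , w) = polynomial-identity x y z w
    where
    polynomial-identity : ∀ x y z w →
      let X = - (+ 2 * w) - + 1 ; Y = + 2 * x ; Z = - (+ 2 * z) - + 1 ; W = + 2 * y in
      + 9 * (X * X) + + 2 * X + (+ 9 * (Y * Y) + + 4 * Y) + (+ 9 * (Z * Z) + + 6 * Z) + (+ 9 * (W * W) + + 8 * W)
        ≡ + 4 * (+ 9 * (x * x) + + 2 * x + (+ 9 * (y * y) + + 4 * y)
                 + (+ 9 * (z * z) + + 6 * z) + (+ 9 * (w * w) + + 8 * w)) + + 10
    polynomial-identity = solve-∀

  sizeλ-φ : ∀ v → sizeλ 9 (embed9 (φ v)) ≡ 4 ℕ.* sizeλ 9 (embed9 v) ℕ.+ 10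
  sizeλ-φ v = +-injective (begin
    + sizeλ 9 (embed9 (φ v)) ≡⟨ sizeλ-embed9 (φ v) ⟩
    size9 (φ v) ≡⟨ size9-φ v ⟩
    + 4 * size9 v + + 10 ≡⟨ cong (λ X → + 4 * X + + 10) (sizeλ-embed9 v) ⟨
    + 4 * + sizeλ 9 (embed9 v) + + 10 ≡⟨ cong (λ X → X + + 10) (pos-* 4 (sizeλ 9 (embed9 v))) ⟨
    + (4 ℕ.* sizeλ 9 (embed9 v)) + + 10 ≡⟨ pos-+ (4 ℕ.* sizeλ 9 (embed9 v)) 10 ⟨
    + (4 ℕ.* sizeλ 9 (embed9 v) ℕ.+ 10) ∎)
    where open ≡-Reasoning

  embed9-sum≡0 : ∀ v → sumℤ 9 (embed9 v) ≡ + 0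
  embed9-sum≡0 (x , y , z , w) = cancellation x y z w
    where
    cancellation : ∀ x y z w → - w + (- z + (- y + (- x + (+ 0 + (x + (y + (z + (w + + 0)))))))) ≡ + 0
    cancellation = solve-∀

  embed9-antisymmetric : ∀ v j → embed9 v (opposite j) ≡ - embed9 v j
  embed9-antisymmetric (x , y , z , w) zero = sym (neg-involutive w)
  embed9-antisymmetric (x , y , z , w) (suc zero) = sym (neg-involutive z)
  embed9-antisymmetric (x , y , z , w) (suc (suc zero)) = sym (neg-involutive y)
  embed9-antisymmetric (x , y , z , w) (suc (suc (suc zero))) = sym (neg-involutive x)
  embed9-antisymmetric v (suc (suc (suc (suc zero)))) = refl
  embed9-antisymmetric v (suc (suc (suc (suc (suc zero))))) = refl
  embed9-antisymmetric v (suc (suc (suc (suc (suc (suc zero)))))) = refl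
  embed9-antisymmetric v (suc (suc (suc (suc (suc (suc (suc zero))))))) = refl
  embed9-antisymmetric v (suc (suc (suc (suc (suc (suc (suc (suc zero)))))))) = refl

  double-injective : ∀ {a b} → + 2 * a ≡ + 2 * b → a ≡ b
  double-injective {a} {b} = *-cancelˡ-≡ (+ 2) a b

  negated-odd-injective : ∀ {a b} → - (+ 2 * a) - + 1 ≡ - (+ 2 * b) - + 1 → a ≡ b
  negated-odd-injective {a} {b} eq = double-injective (neg-injective (begin
    - (+ 2 * a) ≡⟨ add-back (- (+ 2 * a)) ⟨
    - (+ 2 * a) - + 1 + + 1 ≡⟨ cong (λ X → X + + 1) eq ⟩
    - (+ 2 * b) - + 1 + + 1 ≡⟨ add-back (- (+ 2 * b)) ⟩
    - (+ 2 * b) ∎))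
    where
    open ≡-Reasoning
    add-back : ∀ X → X - + 1 + + 1 ≡ X
    add-back = solve-∀

  φ-injective : ∀ {u v} → φ u ≡ φ v → u ≡ v
  φ-injective eq with ,-injective eq
  ... | w≡ , eq′ with ,-injective eq′
  ... | x≡ , eq″ with ,-injective eq″
  ... | z≡ , y≡ = cong₂ _,_ (double-injective x≡) (cong₂ _,_ (double-injective y≡)
                    (cong₂ _,_ (negated-odd-injective z≡) (negated-odd-injective w≡)))

open NineRunners
open import Data.Nat using (_+_; _*_)

theorem5p15 : (n : ℕ)
    → ((v : Tuple4) → SC9 n v → SC9 (4 * n + 10) (φ v))
      × ((u v : Tuple4) → SC9 n u → SC9 n v → φ u ≡ φ v → u ≡ v)
theorem5p15 n = preserves , λ _ _ _ _ → φ-injective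
  where
  preserves : (v : Tuple4) → SC9 n v → SC9 (4 * n + 10) (φ v)
  preserves v (_ , λs , isλ , size≡n , conj≡) with selfConjugate-λ (embed9 (φ v)) (embed9-antisymmetric (φ v))
  ... | μ , isμ , size-μ , conj-μ = embed9-sum≡0 (φ v) , μ , isμ , size≡ , conj-μ
    where
    open ≡-Reasoning
    size≡ : size μ ≡ 4 * n + 10
    size≡ = begin
      size μ ≡⟨ size-μ ⟩
      sizeλ 9 (embed9 (φ v)) ≡⟨ sizeλ-φ v ⟩
      4 * sizeλ 9 (embed9 v) + 10 ≡⟨ cong (λ m → 4 * m + 10) (size≡sizeλ (embed9 v) isλ conj≡) ⟨
      4 * size λs + 10 ≡⟨ cong (λ m → 4 * m + 10) size≡n ⟩
      4 * n + 10 ∎
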